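{- Let $t$ be a positive integer. Let $R=(r_1,\ldots,r_m)$ and $S=(s_1,\ldots,s_{tm})$ be monotone nonincreasing, nonnegative integral vectors such that $\mathcal{A}(R,S)$ is nonempty. Then there exists a matrix $A\in\mathcal{A}(R,S)$ with $\rho_t(A)=tm$ if and only if \[t_{ef}(R,S)+te+f\ge tm\quad (0\le e\le m,\ 0\le f\le tm).\]
   Context: $\mathcal{A}(R,S)$ is the class of all $(0,1)$-matrices with row sum vector $R$ and column sum vector $S$ (here $m\times tm$). For $0\le e\le m$, $0\le f\le tm$, $t_{ef}(R,S)=ef-\sum_{j=1}^f s_j+\sum_{i=e+1}^m r_i$. For a $(0,1)$-matrix $A$, the $t$-term rank $\rho_t(A)$ is the maximum number of $1$s of $A$ that can be chosen with at most one chosen $1$ in each column and at most $t$ chosen $1$s in each row. -}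

module Defs where

open import Data.Nat using (ℕ; zero; suc; _+_; _*_; _≤_; _<ᵇ_)
open import Data.Fin using (Fin; toℕ) renaming (zero to fz; suc to fs)
open import Data.Bool using (Bool; true; false; if_then_else_; _∧_; not)
open import Data.Product using (Σ; _×_; ∃)
open import Data.Integer as ℤ using (ℤ; +_)
open import Relation.Binary.PropositionalEquality using (_≡_)

Matrix : ℕ → ℕ → Set
Matrix m n = Fin m → Fin n → Bool

sumFin : (n : ℕ) → (Fin n → ℕ) → ℕ
sumFin zero    g = 0
sumFin (suc n) g = g fz + sumFin n (λ i → g (fs i))

bit : Bool → ℕ
bit true  = 1
bit false = 0

rowSum : ∀ {m n} → Matrix m n → Fin m → ℕ
rowSum {m} {n} A i = sumFin n (λ j → bit (A i j))

colSum : ∀ {m n} → Matrix m n → Fin n → ℕ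
colSum {m} {n} A j = sumFin m (λ i → bit (A i j))

total : ∀ {m n} → Matrix m n → ℕ
total {m} {n} A = sumFin m (λ i → rowSum A i)

Nonincreasing : ∀ {n} → (Fin n → ℕ) → Set
Nonincreasing {n} v = (i j : Fin n) → toℕ i ≤ toℕ j → v j ≤ v i

InClass : ∀ {m n} → (Fin m → ℕ) → (Fin n → ℕ) → Matrix m n → Set
InClass R S A = ((i : _) → rowSum A i ≡ R i) × ((j : _) → colSum A j ≡ S j)

TSelection : ∀ {m n} → ℕ → Matrix m n → Matrix m n → Set
TSelection t A C =
  ((i : _) (j : _) → C i j ≡ true → A i j ≡ true)
  × ((j : _) → colSum C j ≤ 1)
  × ((i : _) → rowSum C i ≤ t)

TTermRankIs : ∀ {m n} → ℕ → Matrix m n → ℕ → Set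
TTermRankIs t A k =
  (Σ _ λ C → TSelection t A C × total C ≡ k)
  × (∀ C → TSelection t A C → total C ≤ k)

-- partial sums: Σ_{i=1}^{f} v_i  (1-based), and Σ_{i=e+1}^{n} v_i
sumFirst : ∀ {n} → ℕ → (Fin n → ℕ) → ℕ
sumFirst {n} f v = sumFin n (λ j → if toℕ j <ᵇ f then v j else 0)

sumAfter : ∀ {n} → ℕ → (Fin n → ℕ) → ℕ
sumAfter {n} e v = sumFin n (λ i → if toℕ i <ᵇ e then 0 else v i)

tef : ∀ {m n} → (Fin m → ℕ) → (Fin n → ℕ) → ℕ → ℕ → ℤ
tef R S e f = (+ (e * f) ℤ.- + sumFirst f S) ℤ.+ + sumAfter e R

-- A t-selection of size tm meets every column once and every row t times, so A ∈ 𝒜(R,S) with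
-- ρ_t(A) = tm amounts to a pair C ⊆ A with C ∈ 𝒜((t,…,t),(1,…,1)) and A − C ∈ 𝒜(R − t, S − 1).
-- Necessity is a count of the ones of A and C in the rows 1..e and columns 1..f. Conversely, for
-- nonincreasing R and S the inequalities are the Gale–Ryser conditions for 𝒜(R − t, S − 1). More
-- generally, if 𝒜(R,S) and 𝒜(R − t, S − U) (with |U| = tm columns) both satisfy the Gale–Ryser
-- conditions, a nested pair exists: fill a column outside U with its largest rows, or, when every
-- nonzero column lies in U, fill the first row greedily; either deletion preserves both families of
-- inequalities, so induction on Σ S finishes the construction.
module Submission where

open import Defs
open import Data.Nat using (ℕ; zero; suc; _+_; _*_; _∸_; _≤_; _<_; z≤n; s≤s; _<ᵇ_; _⊓_; _≤?_)
open import Data.Nat.Properties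
open import Data.Fin using (Fin; toℕ) renaming (zero to fz; suc to fs)
open import Data.Bool using (Bool; true; false; if_then_else_; _∧_; _∨_; not; T)
open import Data.Bool.Properties using (T-≡; ∧-zeroʳ; ∧-identityʳ; ∨-zeroʳ)
open import Data.Product using (Σ; _×_; _,_; proj₁; proj₂)
open import Data.Sum using (_⊎_; inj₁; inj₂)
open import Data.Empty using (⊥; ⊥-elim)
open import Relation.Binary.PropositionalEquality
open import Relation.Nullary using (yes; no)
open import Function.Base using (_∘_)
open import Function.Bundles using (_⇔_; mk⇔; Equivalence)
import Data.Vec.Functional as Vector
open import Algebra.Properties.CommutativeSemigroup +-commutativeSemigroup using (interchange; xy∙z≈xz∙y)
open import Data.Nat.Tactic.RingSolver using (solve-∀)

module ℤ where
  open import Data.Integer public using (ℤ; +_; _+_; _-_; -_; _≤_; +≤+)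
  open import Data.Integer.Properties public using (drop‿+≤+; pos-+; +-monoˡ-≤)
  open import Data.Integer.Tactic.RingSolver public using (solve-∀)

-- Finite sums

sumFin-cong : ∀ n {g h : Fin n → ℕ} → (∀ i → g i ≡ h i) → sumFin n g ≡ sumFin n h
sumFin-cong zero    p = refl
sumFin-cong (suc n) p = cong₂ _+_ (p fz) (sumFin-cong n (λ i → p (fs i)))

sumFin-mono : ∀ n {g h : Fin n → ℕ} → (∀ i → g i ≤ h i) → sumFin n g ≤ sumFin n h
sumFin-mono zero    p = z≤n
sumFin-mono (suc n) p = +-mono-≤ (p fz) (sumFin-mono n (λ i → p (fs i)))

sumFin-+ : ∀ n (g h : Fin n → ℕ) → sumFin n (λ i → g i + h i) ≡ sumFin n g + sumFin n h
sumFin-+ zero    g h = refl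
sumFin-+ (suc n) g h rewrite sumFin-+ n (λ i → g (fs i)) (λ i → h (fs i)) =
  interchange (g fz) (h fz) (sumFin n (λ i → g (fs i))) (sumFin n (λ i → h (fs i)))

sumFin-zero : ∀ n → sumFin n (λ _ → 0) ≡ 0
sumFin-zero zero    = refl
sumFin-zero (suc n) = sumFin-zero n

sumFin-const : ∀ n c → sumFin n (λ _ → c) ≡ n * c
sumFin-const zero    c = refl
sumFin-const (suc n) c = cong (c +_) (sumFin-const n c)

sumFin-*ˡ : ∀ n c (g : Fin n → ℕ) → sumFin n (λ i → c * g i) ≡ c * sumFin n g
sumFin-*ˡ zero    c g = sym (*-zeroʳ c)
sumFin-*ˡ (suc n) c g rewrite sumFin-*ˡ n c (λ i → g (fs i)) = sym (*-distribˡ-+ c (g fz) _)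

sumFin-swap : ∀ m n (g : Fin m → Fin n → ℕ) →
  sumFin m (λ i → sumFin n (g i)) ≡ sumFin n (λ j → sumFin m (λ i → g i j))
sumFin-swap zero    n g = sym (sumFin-zero n)
sumFin-swap (suc m) n g = begin
  sumFin n (g fz) + sumFin m (λ i → sumFin n (g (fs i)))
    ≡⟨ cong (sumFin n (g fz) +_) (sumFin-swap m n (λ i → g (fs i))) ⟩
  sumFin n (g fz) + sumFin n (λ j → sumFin m (λ i → g (fs i) j))
    ≡⟨ sym (sumFin-+ n (g fz) _) ⟩
  sumFin n (λ j → g fz j + sumFin m (λ i → g (fs i) j)) ∎
  where open ≡-Reasoning

sumFin≡0⇒≡0 : ∀ n (g : Fin n → ℕ) → sumFin n g ≡ 0 → ∀ j → g j ≡ 0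
sumFin≡0⇒≡0 (suc n) g p fz     = m+n≡0⇒m≡0 (g fz) p
sumFin≡0⇒≡0 (suc n) g p (fs j) = sumFin≡0⇒≡0 n (λ i → g (fs i)) (m+n≡0⇒n≡0 (g fz) p) j

sumFin-squeeze : ∀ n (g h : Fin n → ℕ) → (∀ i → g i ≤ h i) → sumFin n h ≤ sumFin n g →
  ∀ i → h i ≤ g i
sumFin-squeeze (suc n) g h g≤h Σh≤Σg fz = +-cancelʳ-≤ (sumFin n (λ i → h (fs i))) _ _
  (≤-trans Σh≤Σg (+-monoʳ-≤ (g fz) (sumFin-mono n (λ i → g≤h (fs i)))))
sumFin-squeeze (suc n) g h g≤h Σh≤Σg (fs i) =
  sumFin-squeeze n (λ i → g (fs i)) (λ i → h (fs i)) (λ i → g≤h (fs i))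
    (+-cancelˡ-≤ (h fz) _ _ (≤-trans Σh≤Σg (+-monoˡ-≤ (sumFin n (λ i → g (fs i))) (g≤h fz)))) i

<ᵇ-true⇒< : ∀ x y → (x <ᵇ y) ≡ true → x < y
<ᵇ-true⇒< x y p = <ᵇ⇒< x y (Equivalence.from T-≡ p)

<ᵇ-false⇒≥ : ∀ x y → (x <ᵇ y) ≡ false → y ≤ x
<ᵇ-false⇒≥ x y p = ≮⇒≥ (λ x<y → subst T p (<⇒<ᵇ x<y))

<⇒<ᵇ-true : ∀ {x y} → x < y → (x <ᵇ y) ≡ true
<⇒<ᵇ-true x<y = Equivalence.to T-≡ (<⇒<ᵇ x<y)

true≢false : true ≡ false → ⊥
true≢false ()

shrinks : ∀ {a b c k} → a + b ≡ c → 1 ≤ b → c < suc k → a < k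
shrinks {a} a+b≡c 1≤b c≤k = ≤-trans (m<m+n a 1≤b) (≤-trans (≤-reflexive a+b≡c) (≤-pred c≤k))

bit≤1 : ∀ b → bit b ≤ 1
bit≤1 true  = s≤s z≤n
bit≤1 false = z≤n

bit-if : ∀ b → bit b ≡ (if b then 1 else 0)
bit-if true  = refl
bit-if false = refl

bit≡0⇒false : ∀ b → bit b ≡ 0 → b ≡ false
bit≡0⇒false false _ = refl

bit-mono : ∀ a b → (a ≡ true → b ≡ true) → bit a ≤ bit b
bit-mono true  b h rewrite h refl = ≤-refl
bit-mono false b h = z≤n

∸-bit-+-bit : ∀ b s → (b ≡ true → 1 ≤ s) → s ∸ bit b + bit b ≡ s
∸-bit-+-bit true  s h = m∸n+n≡m (h refl)
∸-bit-+-bit false s h = +-identityʳ s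

∧-not-true : ∀ a b → a ∧ not b ≡ true → (a ≡ true) × (b ≡ false)
∧-not-true true false _ = refl , refl

∧-not-intro : ∀ {a b} → a ≡ true → b ≡ false → a ∧ not b ≡ true
∧-not-intro refl refl = refl

∧-not-false : ∀ a b → a ∧ not b ≡ false → a ≡ true → b ≡ true
∧-not-false true true _ _ = refl

-- Subsets of Fin n, as Boolean predicates

_⊆_ : ∀ {n} → (Fin n → Bool) → (Fin n → Bool) → Set
W ⊆ D = ∀ j → W j ≡ true → D j ≡ true

Disjoint : ∀ {n} → (Fin n → Bool) → (Fin n → Bool) → Set
Disjoint A B = ∀ j → A j ≡ true → B j ≡ false

count : ∀ {n} → (Fin n → Bool) → ℕ
count {n} E = sumFin n (λ i → bit (E i))

sumIn : ∀ {n} → (Fin n → Bool) → (Fin n → ℕ) → ℕ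
sumIn {n} F V = sumFin n (λ j → if F j then V j else 0)

sumOut : ∀ {n} → (Fin n → Bool) → (Fin n → ℕ) → ℕ
sumOut {n} E V = sumFin n (λ i → if E i then 0 else V i)

⁅_⁆ : ∀ {n} → Fin n → Fin n → Bool
⁅ fz   ⁆ fz     = true
⁅ fz   ⁆ (fs _) = false
⁅ fs _ ⁆ fz     = false
⁅ fs a ⁆ (fs b) = ⁅ a ⁆ b

⁅⁆-self : ∀ {n} (j : Fin n) → ⁅ j ⁆ j ≡ true
⁅⁆-self fz     = refl
⁅⁆-self (fs j) = ⁅⁆-self j

⁅⁆-true⇒≡ : ∀ {n} (a b : Fin n) → ⁅ a ⁆ b ≡ true → b ≡ a
⁅⁆-true⇒≡ fz     fz     _ = refl
⁅⁆-true⇒≡ (fs a) (fs b) p = cong fs (⁅⁆-true⇒≡ a b p)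

sumIn-⁅⁆ : ∀ n (j0 : Fin n) (g : Fin n → ℕ) → sumIn ⁅ j0 ⁆ g ≡ g j0
sumIn-⁅⁆ (suc n) fz      g = trans (cong (g fz +_) (sumFin-zero n)) (+-identityʳ _)
sumIn-⁅⁆ (suc n) (fs j0) g = sumIn-⁅⁆ n j0 (λ j → g (fs j))

count-⁅⁆ : ∀ n (j0 : Fin n) → count ⁅ j0 ⁆ ≡ 1
count-⁅⁆ n j0 = trans (sumFin-cong n (λ j → bit-if (⁅ j0 ⁆ j))) (sumIn-⁅⁆ n j0 (λ _ → 1))

count-all : ∀ n → count {n} (λ _ → true) ≡ n
count-all zero    = refl
count-all (suc n) = cong suc (count-all n)

count-none : ∀ n → count {n} (λ _ → false) ≡ 0
count-none = sumFin-zero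

sumFin-bit-* : ∀ n (E : Fin n → Bool) k → sumFin n (λ i → bit (E i) * k) ≡ count E * k
sumFin-bit-* n E k = trans (sumFin-cong n (λ i → *-comm (bit (E i)) k)) (trans (sumFin-*ˡ n k _) (*-comm k (count E)))

count-mono : ∀ n {W D : Fin n → Bool} → W ⊆ D → count W ≤ count D
count-mono n W⊆D = sumFin-mono n λ j → bit-mono _ _ (W⊆D j)

count-≤-all : ∀ n (D : Fin n → Bool) → count D ≤ n
count-≤-all n D = ≤-trans (count-mono n {D} (λ _ _ → refl)) (≤-reflexive (count-all n))

count-∨ : ∀ n (A B : Fin n → Bool) → Disjoint A B → count (λ j → A j ∨ B j) ≡ count A + count B
count-∨ n A B disj = trans (sumFin-cong n (λ j → bit-∨ (A j) (B j) (disj j))) (sumFin-+ n _ _)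
  where
  bit-∨ : ∀ a b → (a ≡ true → b ≡ false) → bit (a ∨ b) ≡ bit a + bit b
  bit-∨ true  b h rewrite h refl = refl
  bit-∨ false b h = refl

sumIn+sumOut : ∀ n (E : Fin n → Bool) (V : Fin n → ℕ) → sumIn E V + sumOut E V ≡ sumFin n V
sumIn+sumOut n E V = trans (sym (sumFin-+ n _ _)) (sumFin-cong n λ i → split (E i) (V i))
  where
  split : ∀ b x → (if b then x else 0) + (if b then 0 else x) ≡ x
  split true  x = +-identityʳ x
  split false x = refl

sumIn-≤-count : ∀ n (F : Fin n → Bool) (g : Fin n → ℕ) → (∀ j → g j ≤ 1) → sumIn F g ≤ count F
sumIn-≤-count n F g g≤1 = sumFin-mono n λ j → pick (F j) (g≤1 j)
  where
  pick : ∀ b {x} → x ≤ 1 → (if b then x else 0) ≤ bit b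
  pick true  p = p
  pick false p = z≤n

sumIn-≤-sumFin : ∀ n (F : Fin n → Bool) (g : Fin n → ℕ) → sumIn F g ≤ sumFin n g
sumIn-≤-sumFin n F g = sumFin-mono n λ j → pick (F j) (g j)
  where
  pick : ∀ b x → (if b then x else 0) ≤ x
  pick true  x = ≤-refl
  pick false x = z≤n

sumFin-if : ∀ m (E : Fin m → Bool) c (R : Fin m → ℕ) →
  sumFin m (λ i → if E i then c else R i) ≡ count E * c + sumOut E R
sumFin-if m E c R = trans (sumFin-cong m (λ i → split (E i) (R i))) (trans (sumFin-+ m _ _)
   (cong (_+ sumOut E R) (trans (sumFin-*ˡ m c _) (*-comm c (count E)))))
  where
  split : ∀ b r → (if b then c else r) ≡ c * bit b + (if b then 0 else r)
  split true  r = trans (sym (*-identityʳ c)) (sym (+-identityʳ _))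
  split false r = sym (cong (_+ r) (*-zeroʳ c))

sumOut-positive : ∀ n (V : Fin n → ℕ) → sumOut (λ j → 0 <ᵇ V j) V ≡ 0
sumOut-positive n V = trans (sumFin-cong n (λ i → vanish (V i))) (sumFin-zero n)
  where
  vanish : ∀ r → (if 0 <ᵇ r then 0 else r) ≡ 0
  vanish zero    = refl
  vanish (suc r) = refl

allFalse⊎someTrue : ∀ n (P : Fin n → Bool) → (∀ j → P j ≡ false) ⊎ Σ (Fin n) (λ j → P j ≡ true)
allFalse⊎someTrue zero    P = inj₁ (λ ())
allFalse⊎someTrue (suc n) P with P fz in eq
... | true = inj₂ (fz , eq)
... | false with allFalse⊎someTrue n (λ j → P (fs j))
...   | inj₂ (j , p) = inj₂ (fs j , p)
...   | inj₁ h       = inj₁ λ { fz → eq ; (fs j) → h j }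

TopWithin : ∀ {n} → (Fin n → Bool) → (Fin n → Bool) → (Fin n → ℕ) → Set
TopWithin D W V = ∀ j k → W j ≡ true → W k ≡ false → D k ≡ true → V k ≤ V j

Top : ∀ {n} → (Fin n → Bool) → (Fin n → ℕ) → Set
Top W V = ∀ j k → W j ≡ true → W k ≡ false → V k ≤ V j

argmax : ∀ n (P : Fin n → Bool) (V : Fin n → ℕ) →
  (∀ j → P j ≡ false) ⊎ Σ (Fin n) (λ j → (P j ≡ true) × (∀ k → P k ≡ true → V k ≤ V j))
argmax zero    P V = inj₁ (λ ())
argmax (suc n) P V with argmax n (λ j → P (fs j)) (λ j → V (fs j)) | P fz in p0
... | inj₁ none | false = inj₁ λ { fz → p0 ; (fs j) → none j }
... | inj₁ none | true  =
  inj₂ (fz , p0 , λ { fz _ → ≤-refl ; (fs k) q → ⊥-elim (true≢false (trans (sym q) (none k))) })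
... | inj₂ (j , pj , max) | false =
  inj₂ (fs j , pj , λ { fz q → ⊥-elim (true≢false (trans (sym q) p0)) ; (fs k) q → max k q })
... | inj₂ (j , pj , max) | true with V fz ≤? V (fs j)
...   | yes le = inj₂ (fs j , pj , λ { fz _ → le ; (fs k) q → max k q })
...   | no gt  = inj₂ (fz , p0 , λ { fz _ → ≤-refl ; (fs k) q → ≤-trans (max k q) (<⇒≤ (≰⇒> gt)) })

record Largest {n} (c : ℕ) (D : Fin n → Bool) (V : Fin n → ℕ) : Set where
  field
    members : Fin n → Bool
    ⊆D      : members ⊆ D
    size    : count members ≡ c
    top     : TopWithin D members V

chooseLargest : ∀ n (D : Fin n → Bool) (V : Fin n → ℕ) (c : ℕ) → c ≤ count D → Largest c D V
chooseLargest n D V zero _ = record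
  { members = λ _ → false ; ⊆D = λ _ () ; size = count-none n ; top = λ _ _ () }
chooseLargest n D V (suc c) c<∣D∣ with chooseLargest n D V c (≤-trans (n≤1+n c) c<∣D∣)
... | previous with argmax n (λ j → D j ∧ not (Largest.members previous j)) V
...   | inj₁ none = ⊥-elim (<⇒≱ c<∣D∣ (≤-trans (count-mono n D⊆W) (≤-reflexive size)))
  where
  open Largest previous renaming (members to W)
  D⊆W : D ⊆ W
  D⊆W j dj = ∧-not-false (D j) (W j) (none j) dj
...   | inj₂ (k , pk , max) = record { members = W′ ; ⊆D = W′⊆D ; size = ∣W′∣ ; top = top′ }
  where
  open Largest previous renaming (members to W; ⊆D to W⊆D; size to ∣W∣)
  W′ : Fin n → Bool
  W′ j = W j ∨ ⁅ k ⁆ j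
  dk = proj₁ (∧-not-true (D k) (W k) pk)
  wk = proj₂ (∧-not-true (D k) (W k) pk)
  disjoint : Disjoint W ⁅ k ⁆
  disjoint j wj with ⁅ k ⁆ j in e
  ... | false = refl
  ... | true  = ⊥-elim (true≢false (trans (sym wj) (trans (cong W (⁅⁆-true⇒≡ k j e)) wk)))
  W′⊆D : W′ ⊆ D
  W′⊆D j h with W j in e1 | ⁅ k ⁆ j in e2
  ... | true  | _    = W⊆D j e1
  ... | false | true = trans (cong D (⁅⁆-true⇒≡ k j e2)) dk
  ∣W′∣ : count W′ ≡ suc c
  ∣W′∣ = trans (count-∨ n W ⁅ k ⁆ disjoint) (trans (cong₂ _+_ ∣W∣ (count-⁅⁆ n k)) (+-comm c 1))
  top′ : TopWithin D W′ V
  top′ j l hj hl dl with W l in el | ⁅ k ⁆ l in ekl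
  ... | false | false with W j in ej | ⁅ k ⁆ j in ekj
  ...   | true  | _    = top j l ej el dl
  ...   | false | true rewrite ⁅⁆-true⇒≡ k j ekj = max l (∧-not-intro dl el)

-- The Gale–Ryser inequalities

-- GaleRyser t R V is the Gale–Ryser condition for 𝒜(R − t, V), multiplied out so that no subtraction
-- occurs. Ranging over all row and column sets, not just initial segments, makes it independent of
-- the order of R and V.
GaleRyser : ∀ {m n} → ℕ → (Fin m → ℕ) → (Fin n → ℕ) → Set
GaleRyser {m} {n} t R V = ∀ (E : Fin m → Bool) (F : Fin n → Bool) →
  sumIn F V + t * m ≤ count E * (count F + t) + sumOut E R

GaleRyser-cong : ∀ {m n} t (R : Fin m → ℕ) {V V′ : Fin n → ℕ} → (∀ j → V j ≡ V′ j) →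
  GaleRyser t R V → GaleRyser t R V′
GaleRyser-cong {m} {n} t R V≗V′ gr E F =
  subst (λ x → x + t * m ≤ count E * (count F + t) + sumOut E R)
    (sumFin-cong n (λ j → cong (λ x → if F j then x else 0) (V≗V′ j))) (gr E F)

GaleRyser-transpose : ∀ {m n} t (R : Fin m → ℕ) (V : Fin n → ℕ) → GaleRyser t R V →
  sumFin n V + t * m ≡ sumFin m R →
  ∀ E F → sumIn E R ≤ count E * (count F + t) + sumOut F V
GaleRyser-transpose {m} {n} t R V gr balanced E F = +-cancelʳ-≤ (sumOut E R) _ _ (begin
  sumIn E R + sumOut E R               ≡⟨ sumIn+sumOut m E R ⟩
  sumFin m R                           ≡⟨ sym balanced ⟩
  sumFin n V + t * m                   ≡⟨ cong (_+ t * m) (sym (sumIn+sumOut n F V)) ⟩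
  sumIn F V + sumOut F V + t * m       ≡⟨ swap (sumIn F V) (sumOut F V) (t * m) ⟩
  sumIn F V + t * m + sumOut F V       ≤⟨ +-monoˡ-≤ (sumOut F V) (gr E F) ⟩
  X + sumOut E R + sumOut F V          ≡⟨ swap X (sumOut E R) (sumOut F V) ⟩
  X + sumOut F V + sumOut E R          ∎)
  where
  open ≤-Reasoning
  X = count E * (count F + t)
  swap : ∀ a b c → a + b + c ≡ a + c + b
  swap = solve-∀

GaleRyser-row≤ : ∀ {m n} t (R : Fin m → ℕ) (V : Fin n → ℕ) → GaleRyser t R V →
  sumFin n V + t * m ≡ sumFin m R → ∀ i → R i ≤ count (λ j → 0 <ᵇ V j) + t
GaleRyser-row≤ {m} {n} t R V gr balanced i = begin
  R i                                      ≡⟨ sym (sumIn-⁅⁆ m i R) ⟩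
  sumIn ⁅ i ⁆ R                            ≤⟨ GaleRyser-transpose t R V gr balanced ⁅ i ⁆ positive ⟩
  count ⁅ i ⁆ * (count positive + t) + sumOut positive V
                                           ≡⟨ cong₂ (λ x y → x * (count positive + t) + y)
                                                (count-⁅⁆ m i) (sumOut-positive n V) ⟩
  1 * (count positive + t) + 0             ≡⟨ trans (+-identityʳ _) (*-identityˡ _) ⟩
  count positive + t                       ∎
  where
  open ≤-Reasoning
  positive = λ j → 0 <ᵇ V j

excess : ∀ {n} → (Fin n → ℕ) → ℕ → ℕ
excess {n} V e = sumFin n (λ j → V j ∸ e)

capped : ∀ {m} → (Fin m → ℕ) → ℕ → ℕ
capped {m} R k = sumFin m (λ i → R i ⊓ k)

sumIn≤excess : ∀ {n} (F : Fin n → Bool) (V : Fin n → ℕ) e → sumIn F V ≤ excess V e + e * count F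
sumIn≤excess {n} F V e = ≤-trans (sumFin-mono n (λ j → entry (F j) (V j)))
  (≤-reflexive (trans (sumFin-+ n _ _) (cong (excess V e +_) (sumFin-*ˡ n e _))))
  where
  entry : ∀ b v → (if b then v else 0) ≤ (v ∸ e) + e * bit b
  entry false v = z≤n
  entry true  v rewrite *-identityʳ e | +-comm (v ∸ e) e = m≤n+m∸n v e

sumIn-above : ∀ {n} (V : Fin n → ℕ) e →
  sumIn (λ j → e <ᵇ V j) V ≡ excess V e + e * count (λ j → e <ᵇ V j)
sumIn-above {n} V e = trans (sumFin-cong n (λ j → entry (V j)))
  (trans (sumFin-+ n _ _) (cong (excess V e +_) (sumFin-*ˡ n e _)))
  where
  entry : ∀ v → (if e <ᵇ v then v else 0) ≡ (v ∸ e) + e * bit (e <ᵇ v)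
  entry v with e <ᵇ v in eq
  ... | true  rewrite *-identityʳ e = sym (m∸n+n≡m (<⇒≤ (<ᵇ-true⇒< e v eq)))
  ... | false rewrite *-zeroʳ e | m≤n⇒m∸n≡0 (<ᵇ-false⇒≥ e v eq) = refl

capped≤ : ∀ {m} (E : Fin m → Bool) (R : Fin m → ℕ) k → capped R k ≤ count E * k + sumOut E R
capped≤ {m} E R k = ≤-trans (sumFin-mono m (λ i → entry (E i) (R i)))
  (≤-reflexive (trans (sumFin-+ m _ _) (cong (_+ sumOut E R) (sumFin-bit-* m E k))))
  where
  entry : ∀ b r → r ⊓ k ≤ bit b * k + (if b then 0 else r)
  entry false r = m⊓n≤m r k
  entry true  r rewrite +-identityʳ k | +-identityʳ k = m⊓n≤n r k

capped-above : ∀ {m} (R : Fin m → ℕ) k →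
  count (λ i → k <ᵇ R i) * k + sumOut (λ i → k <ᵇ R i) R ≡ capped R k
capped-above {m} R k = trans (cong (_+ sumOut (λ i → k <ᵇ R i) R) (sym (sumFin-bit-* m (λ i → k <ᵇ R i) k)))
  (trans (sym (sumFin-+ m _ _)) (sumFin-cong m (λ i → entry (R i))))
  where
  entry : ∀ r → bit (k <ᵇ r) * k + (if k <ᵇ r then 0 else r) ≡ r ⊓ k
  entry r with k <ᵇ r in eq
  ... | true  rewrite +-identityʳ k | +-identityʳ k = sym (m≥n⇒m⊓n≡n (<⇒≤ (<ᵇ-true⇒< k r eq)))
  ... | false = sym (m≤n⇒m⊓n≡m (<ᵇ-false⇒≥ k r eq))

-- Only the column set F = {j | V j > |E|} is critical (sumIn-above). If every column of W exceeds
-- |E|, compare with the hypothesis for E without row 0; otherwise no column outside W exceeds |E|,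
-- and compare with the hypothesis for E together with row 0.
GaleRyser-deleteRow : ∀ {m n} t (R : Fin (suc m) → ℕ) (V : Fin n → ℕ) (W : Fin n → Bool) →
  GaleRyser t R V → count W + t ≡ R fz → Top W V →
  GaleRyser t (λ i → R (fs i)) (λ j → V j ∸ bit (W j))
GaleRyser-deleteRow {m} {n} t R V W gr ∣W∣+t top E F =
  ≤-trans (+-monoˡ-≤ (t * m) (sumIn≤excess F V′ e)) (add-columns (excess V′ e) core)
  where
  e = count E
  V′ : Fin n → ℕ
  V′ j = V j ∸ bit (W j)
  R′ : Fin m → ℕ
  R′ i = R (fs i)
  O = sumOut E R′

  add-columns : ∀ P → P + t * m ≤ e * t + O → P + e * count F + t * m ≤ e * (count F + t) + O
  add-columns P h = begin
    P + e * count F + t * m     ≡⟨ xy∙z≈xz∙y P (e * count F) (t * m) ⟩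
    P + t * m + e * count F     ≤⟨ +-monoˡ-≤ (e * count F) h ⟩
    e * t + O + e * count F     ≡⟨ distrib e t O (count F) ⟩
    e * (count F + t) + O       ∎
    where
    open ≤-Reasoning
    distrib : ∀ e t O f → e * t + O + e * f ≡ e * (f + t) + O
    distrib = solve-∀

  core : excess V′ e + t * m ≤ e * t + O
  core with allFalse⊎someTrue n (λ j → W j ∧ not (e <ᵇ V j))
  ... | inj₁ W-above = +-cancelʳ-≤ (count W + e * f + t) _ _ (begin
    excess V′ e + t * m + (count W + e * f + t)   ≡⟨ regroupˡ (excess V′ e) t m (count W) e f ⟩
    excess V′ e + count W + e * f + t * suc m     ≡⟨ cong (λ x → x + e * f + t * suc m) excess-drop ⟩
    excess V e + e * f + t * suc m                ≡⟨ cong (_+ t * suc m) (sym (sumIn-above V e)) ⟩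
    sumIn F* V + t * suc m                        ≤⟨ gr (false Vector.∷ E) F* ⟩
    e * (f + t) + (R fz + O)                      ≡⟨ cong (λ x → e * (f + t) + (x + O)) (sym ∣W∣+t) ⟩
    e * (f + t) + ((count W + t) + O)             ≡⟨ regroupʳ e f t (count W) O ⟩
    e * t + O + (count W + e * f + t)             ∎)
    where
    open ≤-Reasoning
    regroupˡ : ∀ P t m w e f → P + t * m + (w + e * f + t) ≡ P + w + e * f + t * suc m
    regroupˡ = solve-∀
    regroupʳ : ∀ e f t w O → e * (f + t) + ((w + t) + O) ≡ e * t + O + (w + e * f + t)
    regroupʳ = solve-∀
    F* = λ j → e <ᵇ V j
    f = count F*
    W-above-e : ∀ j → W j ≡ true → e < V j
    W-above-e j wj = <ᵇ-true⇒< e (V j) (∧-not-false (W j) (e <ᵇ V j) (W-above j) wj)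
    drop-one : ∀ b v → (b ≡ true → e < v) → (v ∸ bit b) ∸ e + bit b ≡ v ∸ e
    drop-one false v h = +-identityʳ _
    drop-one true zero    h = ⊥-elim (n≮0 (h refl))
    drop-one true (suc v) h = trans (+-comm (v ∸ e) 1) (sym (+-∸-assoc 1 (≤-pred (h refl))))
    excess-drop : excess V′ e + count W ≡ excess V e
    excess-drop = trans (sym (sumFin-+ n _ _)) (sumFin-cong n (λ j → drop-one (W j) (V j) (W-above-e j)))
  ... | inj₂ (w , p) = +-cancelʳ-≤ (f + e * f + t) _ _ (begin
    excess V′ e + t * m + (f + e * f + t)         ≡⟨ regroupˡ (excess V′ e) t m f e ⟩
    excess V′ e + suc e * f + t * suc m           ≤⟨ +-monoˡ-≤ (t * suc m) (+-monoˡ-≤ (suc e * f) excess-shift) ⟩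
    excess V (suc e) + suc e * f + t * suc m      ≡⟨ cong (_+ t * suc m) (sym (sumIn-above V (suc e))) ⟩
    sumIn F* V + t * suc m                        ≤⟨ gr (true Vector.∷ E) F* ⟩
    suc e * (f + t) + O                           ≡⟨ regroupʳ e f t O ⟩
    e * t + O + (f + e * f + t)                   ∎)
    where
    open ≤-Reasoning
    regroupˡ : ∀ P t m f e → P + t * m + (f + e * f + t) ≡ P + suc e * f + t * suc m
    regroupˡ = solve-∀
    regroupʳ : ∀ e f t O → suc e * (f + t) + O ≡ e * t + O + (f + e * f + t)
    regroupʳ = solve-∀
    F* = λ j → suc e <ᵇ V j
    f = count F*
    V-w≤e : V w ≤ e
    V-w≤e = <ᵇ-false⇒≥ e (V w) (proj₂ (∧-not-true (W w) _ p))
    outside-≤e : ∀ j → W j ≡ false → V j ≤ e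
    outside-≤e j wj = ≤-trans (top w j (proj₁ (∧-not-true (W w) _ p)) wj) V-w≤e
    shift : ∀ b v → (b ≡ false → v ≤ e) → (v ∸ bit b) ∸ e ≤ v ∸ suc e
    shift true  v h = ≤-reflexive (∸-+-assoc v 1 e)
    shift false v h rewrite m≤n⇒m∸n≡0 (h refl) = z≤n
    excess-shift : excess V′ e ≤ excess V (suc e)
    excess-shift = sumFin-mono n (λ j → shift (W j) (V j) (outside-≤e j))

-- Dually, only the row set E = {i | R i > |F| + t} is critical (capped-above). If every row of K
-- exceeds |F| + t, compare with the hypothesis for F without column j0; otherwise no row outside K
-- exceeds |F| + t, and compare with the hypothesis for F together with column j0.
GaleRyser-deleteColumn : ∀ {m n} t (R : Fin m → ℕ) (V : Fin n → ℕ) (j0 : Fin n) (K : Fin m → Bool) →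
  GaleRyser t R V → count K ≡ V j0 → Top K R → K ⊆ (λ i → 0 <ᵇ R i) →
  GaleRyser t (λ i → R i ∸ bit (K i)) (λ j → if ⁅ j0 ⁆ j then 0 else V j)
GaleRyser-deleteColumn {m} {n} t R V j0 K gr ∣K∣ top K-positive E F = begin
  sumIn F V′ + t * m                  ≡⟨ cong (_+ t * m) sumIn-F₀ ⟩
  sumIn F₀ V + t * m                  ≤⟨ core ⟩
  capped R′ k                         ≤⟨ sumFin-mono m (λ i → ⊓-monoʳ-≤ (R′ i) (+-monoˡ-≤ t ∣F₀∣≤∣F∣)) ⟩
  capped R′ (count F + t)             ≤⟨ capped≤ E R′ (count F + t) ⟩
  count E * (count F + t) + sumOut E R′ ∎
  where
  open ≤-Reasoning
  R′ : Fin m → ℕ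
  R′ i = R i ∸ bit (K i)
  V′ : Fin n → ℕ
  V′ j = if ⁅ j0 ⁆ j then 0 else V j
  F₀ : Fin n → Bool
  F₀ j = F j ∧ not (⁅ j0 ⁆ j)
  k = count F₀ + t

  sumIn-F₀ : sumIn F V′ ≡ sumIn F₀ V
  sumIn-F₀ = sumFin-cong n λ j → entry (V j) (F j) (⁅ j0 ⁆ j)
    where
    entry : ∀ x a b → (if a then (if b then 0 else x) else 0) ≡ (if a ∧ not b then x else 0)
    entry x true  true  = refl
    entry x true  false = refl
    entry x false b     = refl
  ∣F₀∣≤∣F∣ : count F₀ ≤ count F
  ∣F₀∣≤∣F∣ = count-mono n λ j → ⊆-∧ (F j) (not (⁅ j0 ⁆ j))
    where
    ⊆-∧ : ∀ a b → a ∧ b ≡ true → a ≡ true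
    ⊆-∧ true b _ = refl
  K-rows : ∀ i → K i ≡ true → 1 ≤ R i
  K-rows i ki = <ᵇ-true⇒< 0 (R i) (K-positive i ki)

  core : sumIn F₀ V + t * m ≤ capped R′ k
  core with allFalse⊎someTrue m (λ i → K i ∧ not (k <ᵇ R i))
  ... | inj₁ K-above = begin
    sumIn F₀ V + t * m    ≤⟨ gr (λ i → k <ᵇ R i) F₀ ⟩
    _                     ≡⟨ capped-above R k ⟩
    capped R k            ≡⟨ sumFin-cong m (λ i → sym (keep (R i) (K i) (above i))) ⟩
    capped R′ k           ∎
    where
    above : ∀ i → K i ≡ true → k < R i
    above i ki = <ᵇ-true⇒< k (R i) (∧-not-false (K i) _ (K-above i) ki)
    keep : ∀ r b → (b ≡ true → k < r) → (r ∸ bit b) ⊓ k ≡ r ⊓ k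
    keep r       false h = refl
    keep zero    true  h = ⊥-elim (n≮0 (h refl))
    keep (suc r) true  h = trans (m≥n⇒m⊓n≡n (≤-pred (h refl))) (sym (m≥n⇒m⊓n≡n (<⇒≤ (h refl))))
  ... | inj₂ (w , p) = +-cancelʳ-≤ (count K) _ _ (begin
    sumIn F₀ V + t * m + count K      ≡⟨ xy∙z≈xz∙y (sumIn F₀ V) (t * m) (count K) ⟩
    sumIn F₀ V + count K + t * m      ≡⟨ cong (λ x → sumIn F₀ V + x + t * m) ∣K∣ ⟩
    sumIn F₀ V + V j0 + t * m         ≡⟨ cong (_+ t * m) (sym sumIn-F₁) ⟩
    sumIn F₁ V + t * m                ≤⟨ gr E₁ F₁ ⟩
    count E₁ * (count F₁ + t) + sumOut E₁ R
                                      ≡⟨ cong (λ x → count E₁ * x + sumOut E₁ R) ∣F₁∣ ⟩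
    count E₁ * suc k + sumOut E₁ R    ≡⟨ capped-above R (suc k) ⟩
    capped R (suc k)                  ≤⟨ sumFin-mono m (λ i → shift (R i) (K i) (K-rows i) (outside-≤k i)) ⟩
    sumFin m (λ i → R′ i ⊓ k + bit (K i))
                                      ≡⟨ sumFin-+ m _ _ ⟩
    capped R′ k + count K             ∎)
    where
    R-w≤k : R w ≤ k
    R-w≤k = <ᵇ-false⇒≥ k (R w) (proj₂ (∧-not-true (K w) _ p))
    outside-≤k : ∀ i → K i ≡ false → R i ≤ k
    outside-≤k i ki = ≤-trans (top w i (proj₁ (∧-not-true (K w) _ p)) ki) R-w≤k
    shift : ∀ r b → (b ≡ true → 1 ≤ r) → (b ≡ false → r ≤ k) → r ⊓ suc k ≤ (r ∸ bit b) ⊓ k + bit b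
    shift r false _ h rewrite m≤n⇒m⊓n≡m (h refl) | m≤n⇒m⊓n≡m (m≤n⇒m≤1+n (h refl)) = m≤m+n r 0
    shift zero    true h _ = ⊥-elim (n≮0 (h refl))
    shift (suc r) true _ _ = ≤-reflexive (+-comm 1 (r ⊓ k))
    E₁ : Fin m → Bool
    E₁ i = suc k <ᵇ R i
    F₁ : Fin n → Bool
    F₁ j = F₀ j ∨ ⁅ j0 ⁆ j
    disjoint : Disjoint F₀ ⁅ j0 ⁆
    disjoint j h with ⁅ j0 ⁆ j
    ... | false = refl
    ... | true  = ⊥-elim (true≢false (trans (sym h) (∧-zeroʳ (F j))))
    sumIn-F₁ : sumIn F₁ V ≡ sumIn F₀ V + V j0
    sumIn-F₁ = trans (sumFin-cong n (λ j → split (V j) (F₀ j) (⁅ j0 ⁆ j) (disjoint j)))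
      (trans (sumFin-+ n _ _) (cong (sumIn F₀ V +_) (sumIn-⁅⁆ n j0 V)))
      where
      split : ∀ (x : ℕ) a b → (a ≡ true → b ≡ false) →
        (if a ∨ b then x else 0) ≡ (if a then x else 0) + (if b then x else 0)
      split x true  b h rewrite h refl = sym (+-identityʳ _)
      split x false b h = refl
    ∣F₁∣ : count F₁ + t ≡ suc k
    ∣F₁∣ = cong (_+ t) (trans (count-∨ n F₀ ⁅ j0 ⁆ disjoint)
      (trans (cong (count F₀ +_) (count-⁅⁆ n j0)) (+-comm (count F₀) 1)))

-- Nested pairs

record Nestable (t : ℕ) {m n : ℕ} (R : Fin m → ℕ) (S : Fin n → ℕ) (U : Fin n → Bool) : Set where
  field
    outer      : GaleRyser 0 R S
    residual   : GaleRyser t R (λ j → S j ∸ bit (U j))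
    U-positive : ∀ j → U j ≡ true → 1 ≤ S j
    ∣U∣        : count U ≡ t * m
    balanced   : sumFin m R ≡ sumFin n S

record NestedPair (t : ℕ) {m n : ℕ} (R : Fin m → ℕ) (S : Fin n → ℕ) (U : Fin n → Bool) : Set where
  field
    A C    : Matrix m n
    A-rows : ∀ i → rowSum A i ≡ R i
    A-cols : ∀ j → colSum A j ≡ S j
    C⊆A    : ∀ i j → C i j ≡ true → A i j ≡ true
    C-cols : ∀ j → colSum C j ≡ bit (U j)
    C-rows : ∀ i → rowSum C i ≡ t

NestedPairsBelow : ℕ → ℕ → Set
NestedPairsBelow t k = ∀ {m n} (R : Fin m → ℕ) (S : Fin n → ℕ) (U : Fin n → Bool) →
  sumFin n S < k → Nestable t R S U → NestedPair t R S U

nestedPair-noRows : ∀ t {n} (R : Fin 0 → ℕ) (S : Fin n → ℕ) (U : Fin n → Bool) →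
  Nestable t R S U → NestedPair t R S U
nestedPair-noRows t {n} R S U N = record
  { A = λ () ; C = λ () ; A-rows = λ () ; C⊆A = λ () ; C-rows = λ ()
  ; A-cols = λ j → sym (sumFin≡0⇒≡0 n S (sym balanced) j)
  ; C-cols = λ j → sym (sumFin≡0⇒≡0 n (λ j → bit (U j)) (trans ∣U∣ (*-zeroʳ t)) j)
  }
  where open Nestable N

-- Column j0 (outside U) is filled greedily with the S j0 largest rows, as in the proof of the
-- Gale–Ryser theorem.
module ColumnDeletion {m n} t (R : Fin m → ℕ) (S : Fin n → ℕ) (U : Fin n → Bool)
  (N : Nestable t R S U) (j0 : Fin n) (U-j0 : U j0 ≡ false) where

  open Nestable N

  positive : Fin m → Bool
  positive i = 0 <ᵇ R i

  S-j0≤∣positive∣ : S j0 ≤ count positive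
  S-j0≤∣positive∣ = begin
    S j0                                                   ≡⟨ sym (sumIn-⁅⁆ n j0 S) ⟩
    sumIn ⁅ j0 ⁆ S                                         ≡⟨ sym (+-identityʳ _) ⟩
    sumIn ⁅ j0 ⁆ S + 0                                     ≤⟨ outer positive ⁅ j0 ⁆ ⟩
    count positive * (count ⁅ j0 ⁆ + 0) + sumOut positive R ≡⟨ cong₂ (λ x y → count positive * (x + 0) + y)
                                                                (count-⁅⁆ n j0) (sumOut-positive m R) ⟩
    count positive * 1 + 0                                 ≡⟨ trans (+-identityʳ _) (*-identityʳ _) ⟩
    count positive                                         ∎
    where open ≤-Reasoning

  open Largest (chooseLargest m positive R (S j0) S-j0≤∣positive∣)
    renaming (members to K; ⊆D to K⊆positive; size to ∣K∣; top to K-topWithin)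

  K-top : Top K R
  K-top i l ki kl with positive l in e
  ... | true  = K-topWithin i l ki kl e
  ... | false = ≤-trans (<ᵇ-false⇒≥ 0 (R l) e) z≤n

  K-rows : ∀ i → K i ≡ true → 1 ≤ R i
  K-rows i ki = <ᵇ-true⇒< 0 (R i) (K⊆positive i ki)

  R′ : Fin m → ℕ
  R′ i = R i ∸ bit (K i)

  S′ : Fin n → ℕ
  S′ j = if ⁅ j0 ⁆ j then 0 else S j

  sumFin-R′ : sumFin m R′ + S j0 ≡ sumFin m R
  sumFin-R′ = trans (cong (sumFin m R′ +_) (sym ∣K∣))
    (trans (sym (sumFin-+ m _ _)) (sumFin-cong m λ i → ∸-bit-+-bit (K i) (R i) (K-rows i)))

  sumFin-S′ : sumFin n S′ + S j0 ≡ sumFin n S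
  sumFin-S′ = trans (cong (sumFin n S′ +_) (sym (sumIn-⁅⁆ n j0 S)))
    (trans (sym (sumFin-+ n _ _)) (sumFin-cong n λ j → split (⁅ j0 ⁆ j) (S j)))
    where
    split : ∀ b s → (if b then 0 else s) + (if b then s else 0) ≡ s
    split true  s = refl
    split false s = +-identityʳ s

  reduced : Nestable t R′ S′ U
  reduced = record
    { outer      = GaleRyser-deleteColumn 0 R S j0 K outer ∣K∣ K-top K⊆positive
    ; residual   = GaleRyser-cong t R′ (λ j → commute (⁅ j0 ⁆ j) (S j) (bit (U j)))
        (GaleRyser-deleteColumn t R (λ j → S j ∸ bit (U j)) j0 K residual
          (trans ∣K∣ (cong (S j0 ∸_) (sym (cong bit U-j0)))) K-top K⊆positive)
    ; U-positive = U′-positive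
    ; ∣U∣        = ∣U∣
    ; balanced   = +-cancelʳ-≡ (S j0) _ _ (trans sumFin-R′ (trans balanced (sym sumFin-S′)))
    }
    where
    commute : ∀ b s u → (if b then 0 else s ∸ u) ≡ (if b then 0 else s) ∸ u
    commute true  s u = sym (0∸n≡0 u)
    commute false s u = refl
    U′-positive : ∀ j → U j ≡ true → 1 ≤ S′ j
    U′-positive j uj with ⁅ j0 ⁆ j in e
    ... | true  = ⊥-elim (true≢false (trans (sym uj) (trans (cong U (⁅⁆-true⇒≡ j0 j e)) U-j0)))
    ... | false = U-positive j uj

  addColumn : NestedPair t R′ S′ U → NestedPair t R S U
  addColumn P = record
    { A = A ; C = C ; C⊆A = C⊆A′ ; C-cols = C-cols ; C-rows = C-rows ; A-rows = A-rows′ ; A-cols = A-cols′ }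
    where
    open NestedPair P renaming (A to A′)
    A : Matrix m n
    A i j = A′ i j ∨ (⁅ j0 ⁆ j ∧ K i)
    A′-j0 : ∀ i → A′ i j0 ≡ false
    A′-j0 i = bit≡0⇒false _ (sumFin≡0⇒≡0 m (λ i → bit (A′ i j0))
      (trans (A-cols j0) (cong (λ b → if b then 0 else S j0) (⁅⁆-self j0))) i)
    disjoint : ∀ i j → A′ i j ≡ true → (⁅ j0 ⁆ j ∧ K i) ≡ false
    disjoint i j h with ⁅ j0 ⁆ j in e
    ... | false = refl
    ... | true  = ⊥-elim (true≢false (trans (sym h) (trans (cong (A′ i) (⁅⁆-true⇒≡ j0 j e)) (A′-j0 i))))
    bit-∧ : ∀ b b′ → bit (b ∧ b′) ≡ (if b then bit b′ else 0)
    bit-∧ true  b′ = refl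
    bit-∧ false b′ = refl
    A-rows′ : ∀ i → rowSum A i ≡ R i
    A-rows′ i = trans (count-∨ n (A′ i) (λ j → ⁅ j0 ⁆ j ∧ K i) (disjoint i))
      (trans (cong₂ _+_ (A-rows i)
        (trans (sumFin-cong n (λ j → bit-∧ (⁅ j0 ⁆ j) (K i))) (sumIn-⁅⁆ n j0 (λ _ → bit (K i)))))
      (∸-bit-+-bit (K i) (R i) (K-rows i)))
    A-cols′ : ∀ j → colSum A j ≡ S j
    A-cols′ j = trans (count-∨ m (λ i → A′ i j) (λ i → ⁅ j0 ⁆ j ∧ K i) (λ i → disjoint i j))
      (trans (cong₂ _+_ (A-cols j) (sumFin-cong m (λ i → bit-∧ (⁅ j0 ⁆ j) (K i)))) (column (⁅ j0 ⁆ j) refl))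
      where
      column : ∀ b → ⁅ j0 ⁆ j ≡ b → (if b then 0 else S j) + sumFin m (λ i → if b then bit (K i) else 0) ≡ S j
      column true  e rewrite ⁅⁆-true⇒≡ j0 j e = ∣K∣
      column false e = trans (cong (S j +_) (sumFin-zero m)) (+-identityʳ _)
    C⊆A′ : ∀ i j → C i j ≡ true → A i j ≡ true
    C⊆A′ i j h rewrite C⊆A i j h = refl

-- Row 0 receives its r0 − t ones of A − C in the r0 − t columns of largest S among those still
-- needing a one of A − C (Z), and its t ones of C in the t columns of largest S among the remaining
-- nonzero columns (Y).
module RowDeletion {m n} t (R : Fin (suc m) → ℕ) (S : Fin n → ℕ) (U : Fin n → Bool)
  (N : Nestable t R S U) (nonzero⊆U : ∀ j → 1 ≤ S j → U j ≡ true) where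

  open Nestable N

  r0 = R fz

  R′ : Fin m → ℕ
  R′ i = R (fs i)

  a : Fin n → ℕ
  a j = S j ∸ bit (U j)

  a≡S∸1 : ∀ j → a j ≡ S j ∸ 1
  a≡S∸1 j with S j in sj
  ... | zero  = 0∸n≡0 (bit (U j))
  ... | suc s rewrite nonzero⊆U j (subst (1 ≤_) (sym sj) (s≤s z≤n)) = refl

  positiveS positiveA : Fin n → Bool
  positiveS j = 0 <ᵇ S j
  positiveA j = 0 <ᵇ a j

  t≤r0 : t ≤ r0
  t≤r0 = +-cancelˡ-≤ (t * m) t r0 (begin
    t * m + t                                           ≡⟨ trans (+-comm (t * m) t) (sym (*-suc t m)) ⟩
    t * suc m                                           ≡⟨ cong (_+ t * suc m) (sym (sumFin-zero n)) ⟩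
    sumIn (λ _ → false) a + t * suc m                   ≤⟨ residual (false Vector.∷ λ _ → true) (λ _ → false) ⟩
    count {m} (λ _ → true) * (count {n} (λ _ → false) + t) + (r0 + sumOut {m} (λ _ → true) R′)
                                                        ≡⟨ cong₂ (λ x y → x * (y + t) + (r0 + sumFin m (λ _ → 0)))
                                                             (count-all m) (count-none n) ⟩
    m * t + (r0 + sumFin m (λ _ → 0))                   ≡⟨ cong₂ _+_ (*-comm m t) (cong (r0 +_) (sumFin-zero m)) ⟩
    t * m + (r0 + 0)                                    ≡⟨ cong (t * m +_) (+-identityʳ r0) ⟩
    t * m + r0                                          ∎)
    where open ≤-Reasoning

  sumFin-a : sumFin n a + t * suc m ≡ sumFin (suc m) R
  sumFin-a = trans (cong (sumFin n a +_) (sym ∣U∣)) (trans (sym (sumFin-+ n _ _))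
    (trans (sumFin-cong n (λ j → ∸-bit-+-bit (U j) (S j) (U-positive j))) (sym balanced)))

  r0≤∣positiveS∣ : r0 ≤ count positiveS
  r0≤∣positiveS∣ = ≤-trans (GaleRyser-row≤ 0 R S outer (trans (+-identityʳ _) (sym balanced)) fz)
    (≤-reflexive (+-identityʳ _))

  r0∸t≤∣positiveA∣ : r0 ∸ t ≤ count positiveA
  r0∸t≤∣positiveA∣ = ≤-trans (∸-monoˡ-≤ t (GaleRyser-row≤ t R a residual sumFin-a fz))
    (≤-reflexive (m+n∸n≡m _ t))

  -- Only the specification of the choices matters; unfolding chooseLargest would make checking blow up.
  opaque
    Z-choice : Largest (r0 ∸ t) positiveA S
    Z-choice = chooseLargest n positiveA S (r0 ∸ t) r0∸t≤∣positiveA∣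

  open Largest Z-choice
    renaming (members to Z; ⊆D to Z⊆positiveA; size to ∣Z∣; top to Z-top)

  Z-big : ∀ j → Z j ≡ true → 2 ≤ S j
  Z-big j zj = two≤ (S j) (subst (1 ≤_) (a≡S∸1 j) (<ᵇ-true⇒< 0 (a j) (Z⊆positiveA j zj)))
    where
    two≤ : ∀ s → 1 ≤ s ∸ 1 → 2 ≤ s
    two≤ (suc (suc s)) _ = s≤s (s≤s z≤n)

  remaining : Fin n → Bool
  remaining j = positiveS j ∧ not (Z j)

  t≤∣remaining∣ : t ≤ count remaining
  t≤∣remaining∣ = +-cancelʳ-≤ (r0 ∸ t) t (count remaining) (begin
    t + (r0 ∸ t)                    ≡⟨ m+[n∸m]≡n t≤r0 ⟩
    r0                              ≤⟨ r0≤∣positiveS∣ ⟩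
    count positiveS                 ≡⟨ sym (trans (sym (sumFin-+ n _ _)) (sumFin-cong n split)) ⟩
    count remaining + count Z       ≡⟨ cong (count remaining +_) ∣Z∣ ⟩
    count remaining + (r0 ∸ t)      ∎)
    where
    open ≤-Reasoning
    split : ∀ j → bit (remaining j) + bit (Z j) ≡ bit (positiveS j)
    split j with Z j in zj
    ... | false = trans (+-identityʳ _) (cong bit (∧-identityʳ (positiveS j)))
    ... | true  rewrite <⇒<ᵇ-true {0} {S j} (≤-trans (s≤s z≤n) (Z-big j zj)) = refl

  opaque
    Y-choice : Largest t remaining S
    Y-choice = chooseLargest n remaining S t t≤∣remaining∣

  open Largest Y-choice
    renaming (members to Y; ⊆D to Y⊆remaining; size to ∣Y∣; top to Y-top)

  Y-positive : ∀ j → Y j ≡ true → 1 ≤ S j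
  Y-positive j yj = <ᵇ-true⇒< 0 (S j) (proj₁ (∧-not-true (positiveS j) (Z j) (Y⊆remaining j yj)))

  Y-outside-Z : ∀ j → Y j ≡ true → Z j ≡ false
  Y-outside-Z j yj = proj₂ (∧-not-true (positiveS j) (Z j) (Y⊆remaining j yj))

  X : Fin n → Bool
  X j = Z j ∨ Y j

  X-positive : ∀ j → X j ≡ true → 1 ≤ S j
  X-positive j xj with Z j in zj
  ... | true  = ≤-trans (s≤s z≤n) (Z-big j zj)
  ... | false = Y-positive j xj

  ∣X∣ : count X + 0 ≡ r0
  ∣X∣ = trans (+-identityʳ _) (trans (count-∨ n Z Y Z-disjoint-Y) (trans (cong₂ _+_ ∣Z∣ ∣Y∣) (m∸n+n≡m t≤r0)))
    where
    Z-disjoint-Y : Disjoint Z Y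
    Z-disjoint-Y j zj with Y j in yj
    ... | false = refl
    ... | true  = ⊥-elim (true≢false (trans (sym zj) (Y-outside-Z j yj)))

  Z-dominates : ∀ j l → Z j ≡ true → Z l ≡ false → S l ≤ S j
  Z-dominates j l zj zl with positiveA l in pl
  ... | true  = Z-top j l zj zl pl
  ... | false = ≤-trans S-l≤1 (≤-trans (s≤s z≤n) (Z-big j zj))
    where
    S-l≤1 : S l ≤ 1
    S-l≤1 = m∸n≡0⇒m≤n (trans (sym (a≡S∸1 l)) (n≤0⇒n≡0 (<ᵇ-false⇒≥ 0 (a l) pl)))

  X-top : Top X S
  X-top j l xj xl with Z l in zl | Y l in yl
  ... | false | false with Z j in zj
  ...   | true  = Z-dominates j l zj zl
  ...   | false with S l in sl
  ...     | zero  = z≤n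
  ...     | suc _ = subst (_≤ S j) sl (Y-top j l xj yl (∧-not-intro S-l-positive zl))
    where
    S-l-positive : positiveS l ≡ true
    S-l-positive = <⇒<ᵇ-true (subst (0 <_) (sym sl) (s≤s z≤n))

  Z-top-a : Top Z a
  Z-top-a j l zj zl with positiveA l in pl
  ... | true  = subst₂ _≤_ (sym (a≡S∸1 l)) (sym (a≡S∸1 j)) (∸-monoˡ-≤ 1 (Z-top j l zj zl pl))
  ... | false = ≤-trans (≤-reflexive (n≤0⇒n≡0 (<ᵇ-false⇒≥ 0 (a l) pl))) z≤n

  S′ : Fin n → ℕ
  S′ j = S j ∸ bit (X j)

  U′ : Fin n → Bool
  U′ j = U j ∧ not (Y j)

  Z⊆X : Z ⊆ X
  Z⊆X j zj = cong (_∨ Y j) zj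

  Y⊆X : Y ⊆ X
  Y⊆X j yj = trans (cong (Z j ∨_) yj) (∨-zeroʳ (Z j))

  X⊆U : ∀ j → X j ≡ true → U j ≡ true
  X⊆U j xj = nonzero⊆U j (X-positive j xj)

  residual-reduced : ∀ j → a j ∸ bit (Z j) ≡ S′ j ∸ bit (U′ j)
  residual-reduced j with Z j in zj | Y j in yj | U j in uj
  ... | true  | true  | _     = ⊥-elim (true≢false (trans (sym zj) (Y-outside-Z j yj)))
  ... | true  | false | false = ⊥-elim (true≢false (trans (sym (X⊆U j (Z⊆X j zj))) uj))
  ... | false | true  | false = ⊥-elim (true≢false (trans (sym (X⊆U j (Y⊆X j yj))) uj))
  ... | true  | false | true  = refl
  ... | false | true  | true  = refl
  ... | false | false | true  = refl
  ... | false | false | false = refl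

  U′-positive : ∀ j → U′ j ≡ true → 1 ≤ S′ j
  U′-positive j u′j with Z j in zj | Y j in yj | U j in uj
  ... | true  | false | true  = ∸-monoˡ-≤ 1 (Z-big j zj)
  ... | false | false | true  = U-positive j uj

  U-split : ∀ j → bit (U′ j) + bit (Y j) ≡ bit (U j)
  U-split j with Y j in yj
  ... | true  rewrite X⊆U j (Y⊆X j yj) = refl
  ... | false = trans (+-identityʳ _) (cong bit (∧-identityʳ (U j)))

  sumFin-S′ : sumFin n S′ + r0 ≡ sumFin n S
  sumFin-S′ = trans (cong (sumFin n S′ +_) (trans (sym ∣X∣) (+-identityʳ _)))
    (trans (sym (sumFin-+ n _ _)) (sumFin-cong n λ j → ∸-bit-+-bit (X j) (S j) (X-positive j)))

  reduced : Nestable t R′ S′ U′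
  reduced = record
    { outer      = GaleRyser-deleteRow 0 R S X outer ∣X∣ X-top
    ; residual   = GaleRyser-cong t R′ residual-reduced
        (GaleRyser-deleteRow t R a Z residual (trans (cong (_+ t) ∣Z∣) (m∸n+n≡m t≤r0)) Z-top-a)
    ; U-positive = U′-positive
    ; ∣U∣        = +-cancelʳ-≡ t _ _ (begin
        count U′ + t              ≡⟨ cong (count U′ +_) (sym ∣Y∣) ⟩
        count U′ + count Y        ≡⟨ sym (sumFin-+ n _ _) ⟩
        sumFin n (λ j → bit (U′ j) + bit (Y j)) ≡⟨ sumFin-cong n U-split ⟩
        count U                   ≡⟨ ∣U∣ ⟩
        t * suc m                 ≡⟨ trans (*-suc t m) (+-comm t (t * m)) ⟩
        t * m + t                 ∎)
    ; balanced   = +-cancelʳ-≡ r0 _ _ (trans (+-comm _ r0) (trans balanced (sym sumFin-S′)))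
    }
    where open ≡-Reasoning

  addRow : NestedPair t R′ S′ U′ → NestedPair t R S U
  addRow P = record
    { A = A ; C = C ; C⊆A = C⊆A′ ; C-cols = C-cols′ ; C-rows = C-rows′ ; A-rows = A-rows′ ; A-cols = A-cols′ }
    where
    open NestedPair P renaming (A to A₀; C to C₀)
    A : Matrix (suc m) n
    A = X Vector.∷ A₀
    C : Matrix (suc m) n
    C = Y Vector.∷ C₀
    A-rows′ : ∀ i → rowSum A i ≡ R i
    A-rows′ fz     = trans (sym (+-identityʳ _)) ∣X∣
    A-rows′ (fs i) = A-rows i
    A-cols′ : ∀ j → colSum A j ≡ S j
    A-cols′ j = trans (cong (bit (X j) +_) (A-cols j))
      (trans (+-comm (bit (X j)) _) (∸-bit-+-bit (X j) (S j) (X-positive j)))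
    C⊆A′ : ∀ i j → C i j ≡ true → A i j ≡ true
    C⊆A′ fz     j yj = Y⊆X j yj
    C⊆A′ (fs i) j h  = C⊆A i j h
    C-cols′ : ∀ j → colSum C j ≡ bit (U j)
    C-cols′ j = trans (cong (bit (Y j) +_) (C-cols j)) (trans (+-comm (bit (Y j)) _) (U-split j))
    C-rows′ : ∀ i → rowSum C i ≡ t
    C-rows′ fz     = ∣Y∣
    C-rows′ (fs i) = C-rows i

nestedPair : ∀ t → 1 ≤ t → ∀ k → NestedPairsBelow t k
nestedPair t 1≤t zero    R S U () N
nestedPair t 1≤t (suc k) {zero} R S U _ N = nestedPair-noRows t R S U N
nestedPair t 1≤t (suc k) {suc m} {n} R S U ΣS≤k N
  with allFalse⊎someTrue n (λ j → (0 <ᵇ S j) ∧ not (U j))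
... | inj₂ (j0 , p) = addColumn (nestedPair t 1≤t k R′ S′ U (shrinks sumFin-S′ S-j0-positive ΣS≤k) reduced)
  where
  open ColumnDeletion t R S U N j0 (proj₂ (∧-not-true (0 <ᵇ S j0) (U j0) p))
  S-j0-positive = <ᵇ-true⇒< 0 (S j0) (proj₁ (∧-not-true (0 <ᵇ S j0) (U j0) p))
... | inj₁ none = addRow (nestedPair t 1≤t k R′ S′ U′ (shrinks sumFin-S′ (≤-trans 1≤t t≤r0) ΣS≤k) reduced)
  where
  open RowDeletion t R S U N (λ j 1≤S → ∧-not-false (0 <ᵇ S j) (U j) (none j) (<⇒<ᵇ-true 1≤S))

-- Initial segments of nonincreasing vectors

Nonincreasing-tail : ∀ {n} (V : Fin (suc n) → ℕ) → Nonincreasing V → Nonincreasing (λ j → V (fs j))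
Nonincreasing-tail V ni i j i≤j = ni (fs i) (fs j) (s≤s i≤j)

sumFirst-tail≤ : ∀ n (V : Fin (suc n) → ℕ) → Nonincreasing V → ∀ c → sumFirst c (λ j → V (fs j)) ≤ sumFirst c V
sumFirst-tail≤ n       V ni zero    = ≤-reflexive (trans (sumFin-zero n) (sym (sumFin-zero (suc n))))
sumFirst-tail≤ zero    V ni (suc c) = z≤n
sumFirst-tail≤ (suc n) V ni (suc c) =
  +-mono-≤ (ni fz (fs fz) z≤n) (sumFirst-tail≤ n (λ j → V (fs j)) (Nonincreasing-tail V ni) c)

sumIn≤sumFirst : ∀ n (V : Fin n → ℕ) → Nonincreasing V → ∀ F → sumIn F V ≤ sumFirst (count F) V
sumIn≤sumFirst zero    V ni F = z≤n
sumIn≤sumFirst (suc n) V ni F with F fz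
... | true  = +-monoʳ-≤ (V fz) (sumIn≤sumFirst n (λ j → V (fs j)) (Nonincreasing-tail V ni) (λ j → F (fs j)))
... | false = ≤-trans (sumIn≤sumFirst n (λ j → V (fs j)) (Nonincreasing-tail V ni) (λ j → F (fs j)))
                (sumFirst-tail≤ n V ni (count (λ j → F (fs j))))

sumAfter≤+sumAfter-suc : ∀ n (V : Fin n → ℕ) M → (∀ i → V i ≤ M) → ∀ c → sumAfter c V ≤ M + sumAfter (suc c) V
sumAfter≤+sumAfter-suc zero    V M V≤M c       = z≤n
sumAfter≤+sumAfter-suc (suc n) V M V≤M zero    = +-monoˡ-≤ _ (V≤M fz)
sumAfter≤+sumAfter-suc (suc n) V M V≤M (suc c) = sumAfter≤+sumAfter-suc n (λ i → V (fs i)) M (λ i → V≤M (fs i)) c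

sumAfter≤sumOut : ∀ m (R : Fin m → ℕ) → Nonincreasing R → ∀ E → sumAfter (count E) R ≤ sumOut E R
sumAfter≤sumOut zero    R ni E = z≤n
sumAfter≤sumOut (suc m) R ni E
  with E fz | sumAfter≤sumOut m (λ i → R (fs i)) (Nonincreasing-tail R ni) (λ i → E (fs i))
... | true  | tail = tail
... | false | tail with count (λ i → E (fs i))
...   | zero  = +-monoʳ-≤ (R fz) tail
...   | suc c = ≤-trans (sumAfter≤+sumAfter-suc m (λ i → R (fs i)) (R fz) (λ i → ni fz (fs i) z≤n) c)
                  (+-monoʳ-≤ (R fz) tail)

count-initial : ∀ n e → e ≤ n → count {n} (λ i → toℕ i <ᵇ e) ≡ e
count-initial n       zero    _         = count-none n
count-initial (suc n) (suc e) (s≤s e≤n) = cong suc (count-initial n e e≤n)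

-- The t-term rank

total≡sumFin-colSum : ∀ {m n} (M : Matrix m n) → total M ≡ sumFin n (colSum M)
total≡sumFin-colSum {m} {n} M = sumFin-swap m n (λ i j → bit (M i j))

sumFin-sumIn-rows : ∀ m n (M : Matrix m n) (F : Fin n → Bool) →
  sumFin m (λ i → sumIn F (λ j → bit (M i j))) ≡ sumIn F (colSum M)
sumFin-sumIn-rows m n M F = trans (sumFin-swap m n _) (sumFin-cong n λ j → sym (if-sumFin (F j) (λ i → bit (M i j))))
  where
  if-sumFin : ∀ (b : Bool) (g : Fin m → ℕ) → (if b then sumFin m g else 0) ≡ sumFin m (λ i → if b then g i else 0)
  if-sumFin true  g = refl
  if-sumFin false g = sym (sumFin-zero m)

sumIn-colSum : ∀ {m n} (A : Matrix m n) (S : Fin n → ℕ) → (∀ j → colSum A j ≡ S j) → ∀ F →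
  sumIn F S ≡ sumFin m (λ i → sumIn F (λ j → bit (A i j)))
sumIn-colSum {m} {n} A S cols F =
  trans (sumFin-cong n (λ j → cong (λ x → if F j then x else 0) (sym (cols j)))) (sym (sumFin-sumIn-rows m n A F))

GaleRyser-member : ∀ {m n} (A : Matrix m n) (R : Fin m → ℕ) (S : Fin n → ℕ) → InClass R S A → GaleRyser 0 R S
GaleRyser-member {m} {n} A R S (rows , cols) E F = begin
  sumIn F S + 0                                              ≡⟨ +-identityʳ _ ⟩
  sumIn F S                                                  ≡⟨ sumIn-colSum A S cols F ⟩
  sumFin m (λ i → sumIn F (λ j → bit (A i j)))               ≤⟨ sumFin-mono m (λ i → row i (E i)) ⟩
  sumFin m (λ i → if E i then count F + 0 else R i)          ≡⟨ sumFin-if m E (count F + 0) R ⟩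
  count E * (count F + 0) + sumOut E R                       ∎
  where
  open ≤-Reasoning
  row : ∀ i b → sumIn F (λ j → bit (A i j)) ≤ (if b then count F + 0 else R i)
  row i true  = ≤-trans (sumIn-≤-count n F _ (λ j → bit≤1 (A i j))) (m≤m+n _ 0)
  row i false = ≤-trans (sumIn-≤-sumFin n F _) (≤-reflexive (rows i))

-- A row in E contributes at most t chosen ones and |F| ones in F; a row outside E contributes
-- its R i ones, except that chosen ones inside F are counted twice — at most |F| of those in total.
TSelection-bound : ∀ {m n} t (A C : Matrix m n) (R : Fin m → ℕ) (S : Fin n → ℕ) → InClass R S A →
  TSelection t A C → ∀ E F → total C + sumIn F S ≤ count E * (count F + t) + sumOut E R + count F
TSelection-bound {m} {n} t A C R S (rows , cols) (C⊆A , C-cols , C-rows) E F = begin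
  total C + sumIn F S
    ≡⟨ cong (total C +_) (sumIn-colSum A S cols F) ⟩
  total C + sumFin m (λ i → sumIn F (a i))
    ≡⟨ sym (sumFin-+ m _ _) ⟩
  sumFin m (λ i → rowSum C i + sumIn F (a i))
    ≤⟨ sumFin-mono m (λ i → row i (E i)) ⟩
  sumFin m (λ i → if E i then count F + t else R i + sumIn F (c i))
    ≡⟨ sumFin-if m E (count F + t) _ ⟩
  count E * (count F + t) + sumOut E (λ i → R i + sumIn F (c i))
    ≡⟨ cong (count E * (count F + t) +_) sumOut-split ⟩
  count E * (count F + t) + (sumOut E R + sumOut E (λ i → sumIn F (c i)))
    ≤⟨ +-monoʳ-≤ (count E * (count F + t)) (+-monoʳ-≤ (sumOut E R) chosen-in-F) ⟩
  count E * (count F + t) + (sumOut E R + count F)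
    ≡⟨ sym (+-assoc (count E * (count F + t)) (sumOut E R) (count F)) ⟩
  count E * (count F + t) + sumOut E R + count F ∎
  where
  open ≤-Reasoning
  a c : Fin m → Fin n → ℕ
  a i j = bit (A i j)
  c i j = bit (C i j)
  row : ∀ i b → rowSum C i + sumIn F (a i) ≤ (if b then count F + t else R i + sumIn F (c i))
  row i true  = ≤-trans (+-mono-≤ (C-rows i) (sumIn-≤-count n F _ (λ j → bit≤1 (A i j)))) (≤-reflexive (+-comm t _))
  row i false = begin
    rowSum C i + sumIn F (a i)                         ≤⟨ +-monoˡ-≤ (sumIn F (a i)) C-row-split ⟩
    sumIn F (c i) + sumOut F (a i) + sumIn F (a i)     ≡⟨ +-assoc (sumIn F (c i)) _ _ ⟩
    sumIn F (c i) + (sumOut F (a i) + sumIn F (a i))   ≡⟨ cong (sumIn F (c i) +_) (trans (+-comm (sumOut F (a i)) _) (sumIn+sumOut n F (a i))) ⟩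
    sumIn F (c i) + rowSum A i                         ≡⟨ trans (cong (sumIn F (c i) +_) (rows i)) (+-comm _ (R i)) ⟩
    R i + sumIn F (c i)                                ∎
    where
    entry : ∀ j → c i j ≤ (if F j then c i j else 0) + (if F j then 0 else a i j)
    entry j with F j
    ... | true  = m≤m+n _ 0
    ... | false = bit-mono (C i j) (A i j) (C⊆A i j)
    C-row-split : rowSum C i ≤ sumIn F (c i) + sumOut F (a i)
    C-row-split = ≤-trans (sumFin-mono n entry) (≤-reflexive (sumFin-+ n _ _))
  sumOut-split : sumOut E (λ i → R i + sumIn F (c i)) ≡ sumOut E R + sumOut E (λ i → sumIn F (c i))
  sumOut-split = trans (sumFin-cong m (λ i → split (E i) (R i) (sumIn F (c i)))) (sumFin-+ m _ _)
    where
    split : ∀ b x y → (if b then 0 else x + y) ≡ (if b then 0 else x) + (if b then 0 else y)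
    split true  x y = refl
    split false x y = refl
  chosen-in-F : sumOut E (λ i → sumIn F (c i)) ≤ count F
  chosen-in-F = begin
    sumOut E (λ i → sumIn F (c i))    ≤⟨ sumFin-mono m (λ i → drop (E i) (sumIn F (c i))) ⟩
    sumFin m (λ i → sumIn F (c i))    ≡⟨ sumFin-sumIn-rows m n C F ⟩
    sumIn F (colSum C)                ≤⟨ sumIn-≤-count n F (colSum C) C-cols ⟩
    count F                           ∎
    where
    drop : ∀ b x → (if b then 0 else x) ≤ x
    drop true  x = z≤n
    drop false x = ≤-refl

TefInequalities : ∀ {m n} → ℕ → (Fin m → ℕ) → (Fin n → ℕ) → Set
TefInequalities {m} {n} t R S = ∀ e f → e ≤ m → f ≤ n →
  t * m + sumFirst f S ≤ e * f + sumAfter e R + t * e + f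

tef-inequality⇔ : ∀ {m n} (R : Fin m → ℕ) (S : Fin n → ℕ) N t e f →
  (ℤ.+ N ℤ.≤ (tef R S e f ℤ.+ ℤ.+ (t * e)) ℤ.+ ℤ.+ f) ⇔ (N + sumFirst f S ≤ e * f + sumAfter e R + t * e + f)
tef-inequality⇔ R S N t e f = mk⇔
  (λ h → ℤ.drop‿+≤+ (subst₂ ℤ._≤_ (sym (ℤ.pos-+ N SF)) add-SF (ℤ.+-monoˡ-≤ (ℤ.+ SF) h)))
  (λ h → cancel (subst₂ ℤ._≤_ (ℤ.pos-+ N SF) (sym add-SF) (ℤ.+≤+ h)))
  where
  SF = sumFirst f S
  SA = sumAfter e R
  X = (tef R S e f ℤ.+ ℤ.+ (t * e)) ℤ.+ ℤ.+ f
  add-SF : X ℤ.+ ℤ.+ SF ≡ ℤ.+ (e * f + SA + t * e + f)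
  add-SF = trans (regroup (ℤ.+ (e * f)) (ℤ.+ SF) (ℤ.+ SA) (ℤ.+ (t * e)) (ℤ.+ f))
    (sym (trans (ℤ.pos-+ (e * f + SA + t * e) f) (cong (ℤ._+ ℤ.+ f)
      (trans (ℤ.pos-+ (e * f + SA) (t * e)) (cong (ℤ._+ ℤ.+ (t * e)) (ℤ.pos-+ (e * f) SA))))))
    where
    regroup : ∀ x y z w v → ((((x ℤ.- y) ℤ.+ z) ℤ.+ w) ℤ.+ v) ℤ.+ y ≡ ((x ℤ.+ z) ℤ.+ w) ℤ.+ v
    regroup = ℤ.solve-∀
  cancel : ℤ.+ N ℤ.+ ℤ.+ SF ℤ.≤ X ℤ.+ ℤ.+ SF → ℤ.+ N ℤ.≤ X
  cancel h = subst₂ ℤ._≤_ (undo (ℤ.+ N) (ℤ.+ SF)) (undo X (ℤ.+ SF)) (ℤ.+-monoˡ-≤ (ℤ.- ℤ.+ SF) h)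
    where
    undo : ∀ x c → x ℤ.+ c ℤ.- c ≡ x
    undo = ℤ.solve-∀

InClass⇒balanced : ∀ {m n} {R : Fin m → ℕ} {S : Fin n → ℕ} (A : Matrix m n) → InClass R S A →
  sumFin m R ≡ sumFin n S
InClass⇒balanced {m} {n} A (rows , cols) =
  trans (sym (sumFin-cong m rows)) (trans (total≡sumFin-colSum A) (sumFin-cong n cols))

TTermRank⇒TefInequalities : ∀ t {m} (R : Fin m → ℕ) (S : Fin (t * m) → ℕ) (A : Matrix m (t * m)) →
  InClass R S A → TTermRankIs t A (t * m) → TefInequalities t R S
TTermRank⇒TefInequalities t {m} R S A A∈ ((C , C-selection , total-C) , _) e f e≤m f≤n = begin
  t * m + sumFirst f S                                    ≡⟨ cong (_+ sumFirst f S) (sym total-C) ⟩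
  total C + sumIn F S                                     ≤⟨ TSelection-bound t A C R S A∈ C-selection E F ⟩
  count E * (count F + t) + sumOut E R + count F          ≡⟨ cong₂ (λ x y → x * (y + t) + sumAfter e R + y)
                                                               (count-initial m e e≤m) (count-initial (t * m) f f≤n) ⟩
  e * (f + t) + sumAfter e R + f                          ≡⟨ regroup e f t (sumAfter e R) ⟩
  e * f + sumAfter e R + t * e + f                        ∎
  where
  open ≤-Reasoning
  E = λ (i : Fin m) → toℕ i <ᵇ e
  F = λ (j : Fin (t * m)) → toℕ j <ᵇ f
  regroup : ∀ e f t O → e * (f + t) + O + f ≡ e * f + O + t * e + f
  regroup = solve-∀

TefInequalities⇒GaleRyser : ∀ t {m n} (R : Fin m → ℕ) (S : Fin n → ℕ) → Nonincreasing R → Nonincreasing S →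
  TefInequalities t R S → GaleRyser t R (λ j → S j ∸ 1)
TefInequalities⇒GaleRyser t {m} {n} R S R↓ S↓ H E F = +-cancelʳ-≤ f′ _ _ (begin
  sumIn F a + t * m + f′                  ≡⟨ cong (λ x → x + t * m + f′) sumIn-F ⟩
  sumIn F′ a + t * m + f′                 ≡⟨ xy∙z≈xz∙y (sumIn F′ a) (t * m) f′ ⟩
  sumIn F′ a + f′ + t * m                 ≡⟨ cong (_+ t * m) sumIn-F′ ⟩
  sumIn F′ S + t * m                      ≤⟨ +-monoˡ-≤ (t * m) (sumIn≤sumFirst n S S↓ F′) ⟩
  sumFirst f′ S + t * m                   ≡⟨ +-comm _ (t * m) ⟩
  t * m + sumFirst f′ S                   ≤⟨ H e f′ (count-≤-all m E) (count-≤-all n F′) ⟩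
  e * f′ + sumAfter e R + t * e + f′      ≤⟨ +-monoˡ-≤ f′ (+-mono-≤ (+-mono-≤ (*-monoʳ-≤ e f′≤f) (sumAfter≤sumOut m R R↓ E))
                                                                    (≤-reflexive (*-comm t e))) ⟩
  e * f + sumOut E R + e * t + f′         ≡⟨ cong (_+ f′) (regroup e f t (sumOut E R)) ⟩
  e * (f + t) + sumOut E R + f′           ∎)
  where
  open ≤-Reasoning
  a : Fin n → ℕ
  a j = S j ∸ 1
  e = count E
  f = count F
  F′ : Fin n → Bool
  F′ j = F j ∧ (0 <ᵇ S j)
  f′ = count F′
  f′≤f : f′ ≤ f
  f′≤f = count-mono n λ j → ⊆-∧ (F j) (0 <ᵇ S j)
    where
    ⊆-∧ : ∀ x y → x ∧ y ≡ true → x ≡ true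
    ⊆-∧ true y _ = refl
  sumIn-F : sumIn F a ≡ sumIn F′ a
  sumIn-F = sumFin-cong n λ j → entry (F j) (S j)
    where
    entry : ∀ b s → (if b then s ∸ 1 else 0) ≡ (if b ∧ (0 <ᵇ s) then s ∸ 1 else 0)
    entry true  zero    = refl
    entry true  (suc s) = refl
    entry false s       = refl
  sumIn-F′ : sumIn F′ a + f′ ≡ sumIn F′ S
  sumIn-F′ = trans (sym (sumFin-+ n _ _)) (sumFin-cong n λ j → entry (F j) (S j))
    where
    entry : ∀ b s → (if b ∧ (0 <ᵇ s) then s ∸ 1 else 0) + bit (b ∧ (0 <ᵇ s)) ≡ (if b ∧ (0 <ᵇ s) then s else 0)
    entry true  zero    = refl
    entry true  (suc s) = +-comm s 1
    entry false s       = refl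
  regroup : ∀ e f t O → e * f + O + e * t ≡ e * (f + t) + O
  regroup = solve-∀

GaleRyser⇒columns-positive : ∀ t {m} (R : Fin m → ℕ) (S : Fin (t * m) → ℕ) → GaleRyser t R (λ j → S j ∸ 1) →
  sumFin m R ≡ sumFin (t * m) S → ∀ j → 1 ≤ S j
GaleRyser⇒columns-positive t {m} R S gr balanced j =
  ≤-trans (m≤m+n 1 (S j ∸ 1)) (sumFin-squeeze n S (λ j → 1 + (S j ∸ 1)) (λ j → m≤n+m∸n (S j) 1) sums j)
  where
  open ≤-Reasoning
  n = t * m
  sums : sumFin n (λ j → 1 + (S j ∸ 1)) ≤ sumFin n S
  sums = begin
    sumFin n (λ j → 1 + (S j ∸ 1))                   ≡⟨ sumFin-+ n _ _ ⟩
    count {n} (λ _ → true) + sumFin n (λ j → S j ∸ 1) ≡⟨ trans (cong (_+ sumFin n (λ j → S j ∸ 1)) (count-all n)) (+-comm n _) ⟩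
    sumIn (λ _ → true) (λ j → S j ∸ 1) + n            ≤⟨ gr (λ _ → false) (λ _ → true) ⟩
    count {m} (λ _ → false) * (count {n} (λ _ → true) + t) + sumFin m R
                                                     ≡⟨ cong (λ x → x * (count {n} (λ _ → true) + t) + sumFin m R) (count-none m) ⟩
    sumFin m R                                       ≡⟨ balanced ⟩
    sumFin n S                                       ∎

nestedPair⇒fullTTermRank : ∀ t {m} (R : Fin m → ℕ) (S : Fin (t * m) → ℕ) → NestedPair t R S (λ _ → true) →
  Σ (Matrix m (t * m)) (λ A → InClass R S A × TTermRankIs t A (t * m))
nestedPair⇒fullTTermRank t {m} R S P =
  A , (A-rows , A-cols) , ((C , (C⊆A , ≤-reflexive ∘ C-cols , ≤-reflexive ∘ C-rows) , total-C) , maximal)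
  where
  open NestedPair P
  total-C : total C ≡ t * m
  total-C = trans (sumFin-cong m C-rows) (trans (sumFin-const m t) (*-comm m t))
  maximal : ∀ C′ → TSelection t A C′ → total C′ ≤ t * m
  maximal C′ (_ , C′-cols , _) =
    ≤-trans (≤-reflexive (total≡sumFin-colSum C′)) (≤-trans (sumFin-mono (t * m) C′-cols) (≤-reflexive (count-all (t * m))))

lemma4p4 : (t m : ℕ) → 1 ≤ t →
    (R : Fin m → ℕ) (S : Fin (t * m) → ℕ) →
    Nonincreasing R → Nonincreasing S →
    Σ (Matrix m (t * m)) (InClass R S) →
    (Σ (Matrix m (t * m)) (λ A → InClass R S A × TTermRankIs t A (t * m)))
      ⇔ ((e f : ℕ) → e ≤ m → f ≤ t * m →
          ℤ.+ (t * m) ℤ.≤ (tef R S e f ℤ.+ ℤ.+ (t * e)) ℤ.+ ℤ.+ f)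
lemma4p4 t m 1≤t R S R↓ S↓ (A₀ , A₀∈) = mk⇔ necessary sufficient
  where
  tef⇔ = λ e f → tef-inequality⇔ R S (t * m) t e f
  necessary = λ (A , A∈ , rank) e f e≤m f≤n →
    Equivalence.from (tef⇔ e f) (TTermRank⇒TefInequalities t R S A A∈ rank e f e≤m f≤n)
  sufficient = λ H →
    let residual = TefInequalities⇒GaleRyser t R S R↓ S↓ (λ e f e≤m f≤n → Equivalence.to (tef⇔ e f) (H e f e≤m f≤n))
        balanced = InClass⇒balanced A₀ A₀∈
        nestable = record
          { outer      = GaleRyser-member A₀ R S A₀∈
          ; residual   = residual
          ; U-positive = λ j _ → GaleRyser⇒columns-positive t R S residual balanced j
          ; ∣U∣        = count-all (t * m)
          ; balanced   = balanced
          }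
    in nestedPair⇒fullTTermRank t R S (nestedPair t 1≤t (suc (sumFin (t * m) S)) R S (λ _ → true) ≤-refl nestable)
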